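{- Let $r\geq 2$ be an integer, let $G$ be a finite simple undirected $r$-regular graph, and let $\varphi$ be an edge labeling of $G$. Then $$|V_{int}(G,\varphi)|\leq\left\lfloor\frac{r\cdot|V(G)|-2}{2\cdot(r-1)}\right\rfloor.$$
   Context: An interval is a nonempty finite set of consecutive integers. An edge labeling of a graph $G$ is an injective function $\varphi:E(G)\to\{1,2,\dots,|E(G)|\}$. For a vertex $x$, its spectrum is $S_G(x,\varphi)=\{\varphi(e): e\in E(G),\ e \text{ incident with } x\}$, and $V_{int}(G,\varphi)=\{x\in V(G): S_G(x,\varphi)\text{ is an interval}\}$. -}

module Defs where

open import Data.Nat using (ℕ; zero; suc; _+_; _*_; _∸_; _≤_; _<_; NonZero; s≤s; z≤n)
open import Data.Nat.DivMod using (_/_)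
open import Data.Fin using (Fin)
open import Data.Fin.Properties using (_≟_)
open import Data.Product using (_×_; _,_; proj₁; proj₂; ∃; ∃-syntax)
open import Data.Sum using (_⊎_)
open import Data.List using (List; filter; length)
open import Data.List.Base using () renaming (map to lmap)
open import Data.Vec.Functional using ()
open import Data.Fin.Base using (toℕ)
open import Data.List.Base using ()
open import Data.Fin.Subset using (Subset; _∈_)
open import Relation.Binary.PropositionalEquality using (_≡_; _≢_)
open import Relation.Nullary using (¬_; Dec)
open import Relation.Nullary.Decidable using (_⊎-dec_)
open import Function.Definitions using (Injective)
open import Data.List.Base using () renaming (allFin to allFinL)

record Graph (n m : ℕ) : Set where
  field
    ends : Fin m → Fin n × Fin n

open Graph public

Incident : ∀ {n m} → Graph n m → Fin m → Fin n → Set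
Incident G e x = proj₁ (ends G e) ≡ x ⊎ proj₂ (ends G e) ≡ x

incident? : ∀ {n m} (G : Graph n m) (e : Fin m) (x : Fin n) → Dec (Incident G e x)
incident? G e x = (proj₁ (ends G e) ≟ x) ⊎-dec (proj₂ (ends G e) ≟ x)

-- simple: no loops, and no two distinct edges join the same pair of vertices
IsSimple : ∀ {n m} → Graph n m → Set
IsSimple {n} {m} G =
  (∀ e → proj₁ (ends G e) ≢ proj₂ (ends G e)) ×
  (∀ e f → (∀ x → Incident G e x → Incident G f x) → e ≡ f)

degree : ∀ {n m} → Graph n m → Fin n → ℕ
degree {n} {m} G x = length (filter (λ e → incident? G e x) (allFinL m))

IsRegular : ∀ {n m} → ℕ → Graph n m → Set
IsRegular r G = ∀ x → degree G x ≡ r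

IsEdgeLabeling : ∀ {n m} → Graph n m → (Fin m → ℕ) → Set
IsEdgeLabeling {n} {m} G φ = Injective _≡_ _≡_ φ × (∀ e → 1 ≤ φ e × φ e ≤ m)

InSpectrum : ∀ {n m} → Graph n m → (Fin m → ℕ) → Fin n → ℕ → Set
InSpectrum G φ x k = ∃[ e ] (Incident G e x × φ e ≡ k)

IsInterval : (ℕ → Set) → Set
IsInterval S = (∃[ k ] S k) × (∀ a b c → S a → S b → a ≤ c → c ≤ b → S c)

IsIntervalVertex : ∀ {n m} → Graph n m → (Fin m → ℕ) → Fin n → Set
IsIntervalVertex G φ x = IsInterval (InSpectrum G φ x)

bound : ℕ → ℕ → ℕ
bound zero n = 0
bound (suc zero) n = 0
bound (suc (suc k)) n = (suc (suc k) * n ∸ 2) / (2 * suc k)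

module Submission where

-- Say that an edge e has a next label at a vertex x if φ e + 1 also labels an edge at x.
-- At an interval vertex of degree r every incident edge except the one with the largest label
-- has a next label there, so each interval vertex accounts for at least r − 1 such pairs.
-- Conversely an edge has a next label at no more than one vertex, and the edge with the
-- largest label overall has none, so |V_int| (r − 1) ≤ m − 1; with 2m = rn this is the bound.

open import Defs
open import Data.Nat using (ℕ; zero; suc; _+_; _*_; _∸_; _≤_; _<_; z≤n; s≤s; z<s)
open import Data.Nat.Properties
  using (≤-reflexive; +-mono-≤; +-monoˡ-≤; +-monoʳ-≤; m≤m+n; +-assoc; +-comm; +-identityʳ;
         *-identityʳ; *-comm; *-zeroʳ; ≤∧≢⇒<; n≤1+n; 1+n≰n; m≤n+o⇒m∸n≤o; m+n≤o⇒m≤o∸n; *-monoʳ-≤)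
import Data.Nat.Properties as ℕ
open import Algebra.Properties.Semiring.Sum ℕ.+-*-semiring
  using (sum; sum-remove; sum-cong-≗; ∑-comm; ∑-distrib-+; *-distribʳ-sum)
open import Data.Nat.Tactic.RingSolver using (solve-∀)
open import Data.Nat.DivMod using (_/_; m*n/n≡m; /-monoˡ-≤)
open import Data.Fin using (Fin; zero; suc; punchIn; fromℕ<)
open import Data.Fin.Properties using (_≟_; any?; punchInᵢ≢i; suc-injective)
open import Data.Fin.Subset using (Subset; _∈_; ∣_∣)
open import Data.Fin.Subset.Properties using (_∈?_)
open import Data.Vec using ([]; _∷_)
open import Data.Bool using (true; false; if_then_else_)
open import Data.List using (List; filter; length; tabulate; allFin)
open import Data.List.Extrema.Nat using (argmax; argmax-all; f[xs]≤f[argmax])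
open import Data.List.Membership.Propositional.Properties using (∈-allFin; ∈-filter⁺)
import Data.List.Relation.Unary.All as All
open import Data.List.Relation.Unary.All.Properties using (all-filter)
open import Data.Product using (_×_; _,_; proj₁; proj₂; ∃; ∃-syntax)
open import Data.Sum using (_⊎_; inj₁; inj₂)
open import Data.Unit using (tt)
open import Function using (_∘_; case_of_)
open import Function.Definitions using (Injective)
open import Level using (Level)
open import Relation.Nullary using (Dec; yes; no; does; ¬_; contradiction)
open import Relation.Nullary.Decidable using (_×-dec_; _⊎-dec_)
open import Relation.Unary using (Pred; Decidable)
open import Relation.Binary.PropositionalEquality

private
  variable
    ℓ : Level
    n : ℕ

𝟙 : {P : Set ℓ} → Dec P → ℕ
𝟙 P? = if does P? then 1 else 0

𝟙-yes : {P : Set ℓ} → P → (P? : Dec P) → 𝟙 P? ≡ 1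
𝟙-yes p (yes _) = refl
𝟙-yes p (no ¬p) = contradiction p ¬p

𝟙-no : {P : Set ℓ} → ¬ P → (P? : Dec P) → 𝟙 P? ≡ 0
𝟙-no ¬p (yes p) = contradiction p ¬p
𝟙-no ¬p (no _) = refl

𝟙-mono : {P Q : Set ℓ} → (P → Q) → (P? : Dec P) (Q? : Dec Q) → 𝟙 P? ≤ 𝟙 Q?
𝟙-mono P⇒Q (yes p) Q? = ≤-reflexive (sym (𝟙-yes (P⇒Q p) Q?))
𝟙-mono P⇒Q (no _) Q? = z≤n

𝟙-⊎ : {P Q : Set ℓ} (P? : Dec P) (Q? : Dec Q) → ¬ (P × Q) → 𝟙 (P? ⊎-dec Q?) ≡ 𝟙 P? + 𝟙 Q?
𝟙-⊎ (yes p) (yes q) ¬pq = contradiction (p , q) ¬pq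
𝟙-⊎ (yes _) (no _) _ = refl
𝟙-⊎ (no _) (yes _) _ = refl
𝟙-⊎ (no _) (no _) _ = refl

sum-const : ∀ n k → sum {n} (λ _ → k) ≡ n * k
sum-const zero k = refl
sum-const (suc n) k = cong (k +_) (sum-const n k)

sum-mono-≤ : {f g : Fin n → ℕ} → (∀ i → f i ≤ g i) → sum f ≤ sum g
sum-mono-≤ {zero} f≤g = z≤n
sum-mono-≤ {suc n} f≤g = +-mono-≤ (f≤g zero) (sum-mono-≤ (f≤g ∘ suc))

sum-≤-except : (i : Fin n) {f g : Fin n → ℕ} → (∀ j → j ≢ i → f j ≤ g j) → sum f + g i ≤ f i + sum g
sum-≤-except {suc n} i {f} {g} f≤g = begin
  sum f + g i                                          ≡⟨ cong (_+ g i) (sum-remove f) ⟩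
  f i + sum (f ∘ punchIn i) + g i                      ≤⟨ +-monoˡ-≤ (g i) (+-monoʳ-≤ (f i) rest≤) ⟩
  f i + sum (g ∘ punchIn i) + g i                      ≡⟨ +-assoc (f i) _ (g i) ⟩
  f i + (sum (g ∘ punchIn i) + g i)                    ≡⟨ cong (f i +_) (+-comm _ (g i)) ⟩
  f i + (g i + sum (g ∘ punchIn i))                    ≡⟨ cong (f i +_) (sum-remove g) ⟨
  f i + sum g                                          ∎
  where
  open ℕ.≤-Reasoning
  rest≤ : sum (f ∘ punchIn i) ≤ sum (g ∘ punchIn i)
  rest≤ = sum-mono-≤ (λ j → f≤g (punchIn i j) (punchInᵢ≢i i j))

sum-𝟙-∅ : {P : Pred (Fin n) ℓ} (P? : Decidable P) → (∀ i → ¬ P i) → sum (𝟙 ∘ P?) ≡ 0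
sum-𝟙-∅ {n = n} P? none = begin
  sum (𝟙 ∘ P?)       ≡⟨ sum-cong-≗ (λ i → 𝟙-no (none i) (P? i)) ⟩
  sum {n} (λ _ → 0)  ≡⟨ sum-const n 0 ⟩
  n * 0              ≡⟨ *-zeroʳ n ⟩
  0                  ∎
  where open ≡-Reasoning

sum-𝟙-≤1 : {P : Pred (Fin n) ℓ} (P? : Decidable P) → (∀ i j → P i → P j → i ≡ j) → sum (𝟙 ∘ P?) ≤ 1
sum-𝟙-≤1 {n = zero} P? unique = z≤n
sum-𝟙-≤1 {n = suc n} P? unique with P? zero
... | yes p₀ = ≤-reflexive (cong suc (sum-𝟙-∅ (P? ∘ suc) (λ i pᵢ → 0≢1+n (unique zero (suc i) p₀ pᵢ))))
  where
  0≢1+n : {i : Fin n} → zero ≢ suc i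
  0≢1+n ()
... | no _ = sum-𝟙-≤1 (P? ∘ suc) (λ i j pᵢ pⱼ → suc-injective (unique (suc i) (suc j) pᵢ pⱼ))

sum-𝟙-≟ : (a : Fin n) → sum (λ x → 𝟙 (a ≟ x)) ≡ 1
sum-𝟙-≟ {n = suc n} a = begin
  sum (λ x → 𝟙 (a ≟ x))                       ≡⟨ sum-remove (λ x → 𝟙 (a ≟ x)) ⟩
  𝟙 (a ≟ a) + sum (λ j → 𝟙 (a ≟ punchIn a j)) ≡⟨ cong₂ _+_ (𝟙-yes refl (a ≟ a)) others ⟩
  1                                           ∎
  where
  open ≡-Reasoning
  others : sum (λ j → 𝟙 (a ≟ punchIn a j)) ≡ 0
  others = sum-𝟙-∅ (λ j → a ≟ punchIn a j) (λ j → punchInᵢ≢i a j ∘ sym)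

length-filter-tabulate : {A : Set ℓ} {P : Pred A ℓ} (P? : Decidable P) (f : Fin n → A) →
  length (filter P? (tabulate f)) ≡ sum (𝟙 ∘ P? ∘ f)
length-filter-tabulate {n = zero} P? f = refl
length-filter-tabulate {n = suc n} P? f with P? (f zero)
... | yes _ = cong suc (length-filter-tabulate P? (f ∘ suc))
... | no _ = length-filter-tabulate P? (f ∘ suc)

∣p∣≡sum-𝟙-∈ : (p : Subset n) → ∣ p ∣ ≡ sum (λ x → 𝟙 (x ∈? p))
∣p∣≡sum-𝟙-∈ [] = refl
∣p∣≡sum-𝟙-∈ (true ∷ p) = cong suc (∣p∣≡sum-𝟙-∈ p)
∣p∣≡sum-𝟙-∈ (false ∷ p) = ∣p∣≡sum-𝟙-∈ p

∃-argmax : {P : Pred (Fin n) ℓ} → Decidable P → (f : Fin n → ℕ) → ∃ P → ∃[ i ] (P i × (∀ j → P j → f j ≤ f i))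
∃-argmax {n = n} P? f (i₀ , pᵢ₀) =
  i , argmax-all f pᵢ₀ (all-filter P? (allFin n)) ,
  λ j pⱼ → All.lookup (f[xs]≤f[argmax] {f = f} i₀ candidates) (∈-filter⁺ P? (∈-allFin j) pⱼ)
  where
  candidates : List (Fin n)
  candidates = filter P? (allFin n)
  i : Fin n
  i = argmax f i₀ candidates

module _ {n m : ℕ} (G : Graph n m) where

  private
    variable
      x y z : Fin n
      e f : Fin m

  incident-endpoints : x ≢ y → Incident G e x → Incident G e y → Incident G e z → z ≡ x ⊎ z ≡ y
  incident-endpoints x≢y (inj₁ refl) (inj₁ refl) _ = contradiction refl x≢y
  incident-endpoints x≢y (inj₂ refl) (inj₂ refl) _ = contradiction refl x≢y
  incident-endpoints _ (inj₁ refl) (inj₂ refl) (inj₁ refl) = inj₁ refl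
  incident-endpoints _ (inj₁ refl) (inj₂ refl) (inj₂ refl) = inj₂ refl
  incident-endpoints _ (inj₂ refl) (inj₁ refl) (inj₁ refl) = inj₂ refl
  incident-endpoints _ (inj₂ refl) (inj₁ refl) (inj₂ refl) = inj₁ refl

  degree≡sum-𝟙-incident : ∀ x → degree G x ≡ sum (λ e → 𝟙 (incident? G e x))
  degree≡sum-𝟙-incident x = length-filter-tabulate (λ e → incident? G e x) (λ e → e)

  sum-degree≡edges*2 : (∀ e → proj₁ (ends G e) ≢ proj₂ (ends G e)) → sum (degree G) ≡ m * 2
  sum-degree≡edges*2 loopless = begin
    sum (degree G)                                   ≡⟨ sum-cong-≗ degree≡sum-𝟙-incident ⟩
    sum (λ x → sum (λ e → 𝟙 (incident? G e x)))      ≡⟨ ∑-comm (λ x e → 𝟙 (incident? G e x)) ⟩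
    sum (λ e → sum (λ x → 𝟙 (incident? G e x)))      ≡⟨ sum-cong-≗ two-endpoints ⟩
    sum {m} (λ _ → 2)                                ≡⟨ sum-const m 2 ⟩
    m * 2                                            ∎
    where
    open ≡-Reasoning
    two-endpoints : ∀ e → sum (λ x → 𝟙 (incident? G e x)) ≡ 2
    two-endpoints e = begin
      sum (λ x → 𝟙 (incident? G e x))               ≡⟨ sum-cong-≗ (λ x → 𝟙-⊎ (a ≟ x) (b ≟ x) (not-both x)) ⟩
      sum (λ x → 𝟙 (a ≟ x) + 𝟙 (b ≟ x))             ≡⟨ ∑-distrib-+ (λ x → 𝟙 (a ≟ x)) (λ x → 𝟙 (b ≟ x)) ⟩
      sum (λ x → 𝟙 (a ≟ x)) + sum (λ x → 𝟙 (b ≟ x)) ≡⟨ cong₂ _+_ (sum-𝟙-≟ a) (sum-𝟙-≟ b) ⟩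
      2                                             ∎
      where
      a = proj₁ (ends G e)
      b = proj₂ (ends G e)
      not-both : ∀ x → ¬ (a ≡ x × b ≡ x)
      not-both x (a≡x , b≡x) = loopless e (trans a≡x (sym b≡x))

  regular⇒vertices*r≡edges*2 : ∀ {r} → (∀ e → proj₁ (ends G e) ≢ proj₂ (ends G e)) →
                               IsRegular r G → n * r ≡ m * 2
  regular⇒vertices*r≡edges*2 {r} loopless regular = begin
    n * r                ≡⟨ sum-const n r ⟨
    sum {n} (λ _ → r)    ≡⟨ sum-cong-≗ (sym ∘ regular) ⟩
    sum (degree G)       ≡⟨ sum-degree≡edges*2 loopless ⟩
    m * 2                ∎
    where open ≡-Reasoning

  edge-unique : IsSimple G → x ≢ y →
                Incident G e x → Incident G e y → Incident G f x → Incident G f y → e ≡ f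
  edge-unique (_ , no-parallel) x≢y ex ey fx fy =
    no-parallel _ _ λ z ez → case incident-endpoints x≢y ex ey ez of λ where
      (inj₁ refl) → fx
      (inj₂ refl) → fy

module _ {n m : ℕ} {G : Graph n m} (φ : Fin m → ℕ) where

  private
    variable
      x y : Fin n
      e : Fin m

  HasNextLabel : Fin n → Fin m → Set
  HasNextLabel x e = Incident G e x × InSpectrum G φ x (suc (φ e))

  hasNextLabel? : ∀ x e → Dec (HasNextLabel x e)
  hasNextLabel? x e = incident? G e x ×-dec any? (λ f → incident? G f x ×-dec (φ f ℕ.≟ suc (φ e)))

  nextLabelCount : Fin n → ℕ
  nextLabelCount x = sum (λ e → 𝟙 (hasNextLabel? x e))

  degree≤1+nextLabelCount : Injective _≡_ _≡_ φ → IsIntervalVertex G φ x →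
                            degree G x ≤ 1 + nextLabelCount x
  degree≤1+nextLabelCount {x} φ-inj ((_ , e₀ , e₀∼x , _) , convex)
    with ∃-argmax (λ e → incident? G e x) φ (e₀ , e₀∼x)
  ... | top , top∼x , top-max = begin
    degree G x                                                  ≡⟨ degree≡sum-𝟙-incident G x ⟩
    sum (λ e → 𝟙 (incident? G e x))                             ≤⟨ m≤m+n _ _ ⟩
    sum (λ e → 𝟙 (incident? G e x)) + 𝟙 (hasNextLabel? x top)  ≤⟨ sum-≤-except top below-top ⟩
    𝟙 (incident? G top x) + nextLabelCount x                    ≡⟨ cong (_+ nextLabelCount x) top-incident ⟩
    1 + nextLabelCount x                                        ∎
    where
    open ℕ.≤-Reasoning
    top-incident : 𝟙 (incident? G top x) ≡ 1
    top-incident = 𝟙-yes top∼x (incident? G top x)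
    below-top : ∀ e → e ≢ top → 𝟙 (incident? G e x) ≤ 𝟙 (hasNextLabel? x e)
    below-top e e≢top = 𝟙-mono (λ e∼x → e∼x , next e∼x) (incident? G e x) (hasNextLabel? x e)
      where
      next : Incident G e x → InSpectrum G φ x (suc (φ e))
      next e∼x = convex (φ e) (φ top) (suc (φ e)) (e , e∼x , refl) (top , top∼x , refl) (n≤1+n _)
               (≤∧≢⇒< (top-max e e∼x) (e≢top ∘ φ-inj))

  -- The edge labelled φ e + 1 is unique, so for x ≢ y it would join x and y just as e does.
  hasNextLabel-unique : IsSimple G → Injective _≡_ _≡_ φ →
                        HasNextLabel x e → HasNextLabel y e → x ≡ y
  hasNextLabel-unique {x} {e} {y} simple φ-inj (e∼x , f , f∼x , φf≡) (e∼y , g , g∼y , φg≡)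
    with x ≟ y
  ... | yes x≡y = x≡y
  ... | no x≢y = contradiction (trans (sym φf≡) (cong φ (sym e≡f))) (1+n≰n ∘ ≤-reflexive)
    where
    g≡f : g ≡ f
    g≡f = φ-inj (trans φg≡ (sym φf≡))
    e≡f : e ≡ f
    e≡f = edge-unique G simple x≢y e∼x e∼y f∼x (subst (λ h → Incident G h y) g≡f g∼y)

  sum-nextLabelCount<edges : IsSimple G → Injective _≡_ _≡_ φ → 0 < m → sum nextLabelCount < m
  sum-nextLabelCount<edges simple φ-inj 0<m with ∃-argmax (λ _ → yes tt) φ (fromℕ< 0<m , tt)
  ... | top , _ , top-max = begin
    suc (sum nextLabelCount)        ≡⟨ cong suc (∑-comm (λ x e → 𝟙 (hasNextLabel? x e))) ⟩
    suc (sum owners)                ≡⟨ +-comm 1 (sum owners) ⟩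
    sum owners + 1                  ≤⟨ sum-≤-except top (λ e _ → owners≤1 e) ⟩
    owners top + sum {m} (λ _ → 1)  ≡⟨ cong₂ _+_ top-unowned (sum-const m 1) ⟩
    m * 1                           ≡⟨ *-identityʳ m ⟩
    m                               ∎
    where
    open ℕ.≤-Reasoning
    owners : Fin m → ℕ
    owners e = sum (λ x → 𝟙 (hasNextLabel? x e))
    owners≤1 : ∀ e → owners e ≤ 1
    owners≤1 e = sum-𝟙-≤1 (λ x → hasNextLabel? x e) (λ x y → hasNextLabel-unique simple φ-inj)
    top-unowned : owners top ≡ 0
    top-unowned = sum-𝟙-∅ (λ x → hasNextLabel? x top)
      λ x (_ , f , _ , φf≡) → 1+n≰n (subst (_≤ φ top) φf≡ (top-max f tt))

  ∣S∣*[r∸1]<edges : ∀ {r} → IsSimple G → Injective _≡_ _≡_ φ → IsRegular r G → 0 < m →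
    (S : Subset n) → (∀ x → x ∈ S → IsIntervalVertex G φ x) → ∣ S ∣ * (r ∸ 1) < m
  ∣S∣*[r∸1]<edges {r} simple φ-inj regular 0<m S S-interval = begin-strict
    ∣ S ∣ * (r ∸ 1)                   ≡⟨ cong (_* (r ∸ 1)) (∣p∣≡sum-𝟙-∈ S) ⟩
    sum (λ x → 𝟙 (x ∈? S)) * (r ∸ 1)  ≡⟨ *-distribʳ-sum (r ∸ 1) (λ x → 𝟙 (x ∈? S)) ⟩
    sum (λ x → 𝟙 (x ∈? S) * (r ∸ 1))  ≤⟨ sum-mono-≤ per-vertex ⟩
    sum nextLabelCount                <⟨ sum-nextLabelCount<edges simple φ-inj 0<m ⟩
    m                                 ∎
    where
    open ℕ.≤-Reasoning
    per-vertex : ∀ x → 𝟙 (x ∈? S) * (r ∸ 1) ≤ nextLabelCount x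
    per-vertex x with x ∈? S
    ... | no _ = z≤n
    ... | yes x∈S = begin
      r ∸ 1 + 0          ≡⟨ +-identityʳ (r ∸ 1) ⟩
      r ∸ 1              ≤⟨ m≤n+o⇒m∸n≤o r 1 r≤1+nextLabelCount ⟩
      nextLabelCount x   ∎
      where
      r≤1+nextLabelCount : r ≤ 1 + nextLabelCount x
      r≤1+nextLabelCount = subst (_≤ 1 + nextLabelCount x) (regular x)
                             (degree≤1+nextLabelCount φ-inj (S-interval x x∈S))

s*[1+k]<m⇒s≤bound[2+k] : ∀ {k s n m} → s * suc k < m → n * suc (suc k) ≡ m * 2 → s ≤ bound (suc (suc k)) n
s*[1+k]<m⇒s≤bound[2+k] {k} {s} {n} {m} s*[1+k]<m n*r≡m*2 = begin
  s                              ≡⟨ m*n/n≡m s (2 * suc k) ⟨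
  s * (2 * suc k) / (2 * suc k)  ≤⟨ /-monoˡ-≤ (2 * suc k) (m+n≤o⇒m≤o∸n (s * (2 * suc k)) s*2[1+k]+2≤r*n) ⟩
  bound (suc (suc k)) n          ∎
  where
  open ℕ.≤-Reasoning
  s*2[1+k]+2≤r*n : s * (2 * suc k) + 2 ≤ suc (suc k) * n
  s*2[1+k]+2≤r*n = begin
    s * (2 * suc k) + 2  ≡⟨ regroup s k ⟩
    2 * suc (s * suc k)  ≤⟨ *-monoʳ-≤ 2 s*[1+k]<m ⟩
    2 * m                ≡⟨ *-comm 2 m ⟩
    m * 2                ≡⟨ n*r≡m*2 ⟨
    n * suc (suc k)      ≡⟨ *-comm n _ ⟩
    suc (suc k) * n      ∎
    where
    regroup : ∀ s k → s * (2 * suc k) + 2 ≡ 2 * suc (s * suc k)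
    regroup = solve-∀

corollary1 : (r n m : ℕ) → 2 ≤ r → (G : Graph n m) → IsSimple G → IsRegular r G →
    (φ : Fin m → ℕ) → IsEdgeLabeling G φ →
    (S : Subset n) → (∀ x → x ∈ S → IsIntervalVertex G φ x) →
    ∣ S ∣ ≤ bound r n
corollary1 (suc zero) _ _ (s≤s ()) _ _ _ _ _ _ _
corollary1 (suc (suc _)) zero _ _ _ _ _ _ _ [] _ = z≤n
corollary1 (suc (suc _)) (suc _) zero _ _ _ regular _ _ _ _ with regular zero
... | ()
corollary1 (suc (suc _)) n (suc _) _ G simple regular φ (φ-inj , _) S S-interval =
  s*[1+k]<m⇒s≤bound[2+k] {n = n} (∣S∣*[r∸1]<edges φ simple φ-inj regular z<s S S-interval)
                                 (regular⇒vertices*r≡edges*2 G (proj₁ simple) regular)
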